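{- For every positive integer $n$ and any two sets $A,B \subseteq \{0,1\}^n$ with $|A|=|B|=2^{n-1}$, there exists a bijection $\phi \colon A \to B$ such that $\mathbb{E}_{x \in A}[\mathrm{dist}(x,\phi(x))] \le \sqrt{2n}$, where $x$ is uniform in $A$.
   Context: $\mathrm{dist}$ denotes the Hamming distance on $\{0,1\}^n$. -}

module Defs where

open import Data.Bool using (Bool; true; false; T; _≟_)
open import Data.Nat using (ℕ; zero; suc; _+_)
open import Data.Vec using (Vec; []; _∷_)
open import Data.List using (List; _++_; map; length; filterᵇ) renaming ([] to []ˡ; _∷_ to _∷ˡ_)
open import Relation.Nullary using (yes; no)
open import Data.Nat.ListAction using (sum)

Cube : ℕ → Set
Cube n = Vec Bool n

dist : {n : ℕ} → Cube n → Cube n → ℕ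
dist [] [] = 0
dist (a ∷ x) (b ∷ y) with a ≟ b
... | yes _ = dist x y
... | no  _ = suc (dist x y)

allCube : (n : ℕ) → List (Cube n)
allCube zero = [] ∷ˡ []ˡ
allCube (suc n) = map (false ∷_) (allCube n) ++ map (true ∷_) (allCube n)

SubsetCube : ℕ → Set
SubsetCube n = Cube n → Bool

elems : {n : ℕ} → SubsetCube n → List (Cube n)
elems {n} A = filterᵇ A (allCube n)

card : {n : ℕ} → SubsetCube n → ℕ
card A = length (elems A)

-- φ (a total function on the cube) restricts to a bijection A → B.
IsBijectionOn : {n : ℕ} → SubsetCube n → SubsetCube n → (Cube n → Cube n) → Set
IsBijectionOn {n} A B φ =
  ((x : Cube n) → T (A x) → T (B (φ x)))
  × ((x y : Cube n) → T (A x) → T (A y) → φ x ≡ φ y → x ≡ y)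
  × ((y : Cube n) → T (B y) → Σ (Cube n) (λ x → T (A x) × φ x ≡ y))
  where
  open import Data.Product using (Σ; _×_)
  open import Relation.Binary.PropositionalEquality using (_≡_)

totalDist : {n : ℕ} → SubsetCube n → (Cube n → Cube n) → ℕ
totalDist A φ = sum (map (λ x → dist x (φ x)) (elems A))

{-# OPTIONS --safe #-}

-- The points are matched one coordinate at a time.  Given a matching of A and B with their first
-- coordinate forgotten, the first bits are chosen by colouring the edge ends of the bipartite
-- multigraph whose vertices are the fibres {0x, 1x} of A and of B and whose edges are the matched
-- pairs: each fibre asks for as many ends of each colour as it has points with that first bit, and
-- an edge pays for its first coordinate exactly when it is monochromatic.  Splicing two edges at a
-- vertex that needs both colours shows that at most half of the total fibre imbalance
-- Σₓ ∣ |A ∩ 0x| - |A ∩ 1x| ∣ + (the same for B) is monochromatic.  Hence 2 · cost ≤ D(A) + D(B),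
-- where D sums the fibre imbalances Tᵢ of the successive projections.  By Cauchy–Schwarz
-- D² ≤ n Σ Tᵢ², and the parallelogram law on each fibre telescopes to Σ Tᵢ² + |A|² ≤ 2ⁿ |A|, which
-- is 2 |A|² when |A| = 2ⁿ⁻¹.  So D ≤ √n |A|, and the average cost is at most √n.

module Submission where

open import Defs
open import Data.Bool using (Bool; true; false; not; if_then_else_; T)
import Data.Bool.Properties as Bool
open import Data.Empty using (⊥-elim)
open import Data.List using (List; []; _∷_; _++_; map; length; filterᵇ)
open import Data.List.Properties using (map-++; map-∘; map-cong; map-id; length-map; length-++)
open import Data.List.Membership.Propositional using (_∈_; lose)
open import Data.List.Membership.Propositional.Properties using (∈-map⁺; ∈-map⁻)
open import Data.List.Relation.Unary.All as All using (All; []; _∷_)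
import Data.List.Relation.Unary.All.Properties as All
open import Data.List.Relation.Unary.Any using (here; there; satisfied; any?)
open import Data.List.Relation.Binary.Permutation.Propositional
  using (_↭_; ↭-refl; ↭-reflexive; ↭-sym; ↭-trans; ↭-prep; ↭-swap)
open import Data.List.Relation.Binary.Permutation.Propositional.Properties
  using (map⁺; ↭-map-inv; ↭-length; All-resp-↭)
open import Data.Nat using (ℕ; zero; suc; _+_; _*_; _^_; _∸_; _≤_; z≤n; s≤s; ∣_-_∣; _≤?_)
open import Data.Nat.ListAction using (sum)
open import Data.Nat.ListAction.Properties using (sum-++; sum-↭)
open import Data.Nat.Properties
open import Data.Nat.Tactic.RingSolver using (solve-∀)
open import Data.Product using (Σ; _×_; _,_; proj₁; proj₂; uncurry; swap)
open import Data.Sum using (_⊎_; inj₁; inj₂; [_,_]′; reduce)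
import Data.Sum.Properties as Sum
open import Data.Vec using ([]; _∷_; tail)
import Data.Vec.Properties as Vec
open import Function using (_∘_; id; const)
open import Relation.Binary using (DecidableEquality)
open import Relation.Binary.Consequences using (wlog)
open import Relation.Binary.PropositionalEquality
open import Relation.Nullary using (Dec; yes; no; ¬_; does; _×-dec_)
open import Relation.Nullary.Decidable using (dec-true; dec-false; T?)

private variable A B : Set

∑ : (A → ℕ) → List A → ℕ
∑ f xs = sum (map f xs)

∑-++ : (f : A → ℕ) (xs ys : List A) → ∑ f (xs ++ ys) ≡ ∑ f xs + ∑ f ys
∑-++ f xs ys = trans (cong sum (map-++ f xs ys)) (sum-++ (map f xs) (map f ys))

∑-↭ : (f : A → ℕ) {xs ys : List A} → xs ↭ ys → ∑ f xs ≡ ∑ f ys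
∑-↭ f xs↭ys = sum-↭ (map⁺ f xs↭ys)

∑-cong : {f g : A → ℕ} → (∀ x → f x ≡ g x) → (xs : List A) → ∑ f xs ≡ ∑ g xs
∑-cong f≗g xs = cong sum (map-cong f≗g xs)

∑-cong-All : {f g : A → ℕ} {xs : List A} → All (λ x → f x ≡ g x) xs → ∑ f xs ≡ ∑ g xs
∑-cong-All []            = refl
∑-cong-All (fx≡gx ∷ eqs) = cong₂ _+_ fx≡gx (∑-cong-All eqs)

∑-mono : {f g : A → ℕ} → (∀ x → f x ≤ g x) → (xs : List A) → ∑ f xs ≤ ∑ g xs
∑-mono f≤g []       = z≤n
∑-mono f≤g (x ∷ xs) = +-mono-≤ (f≤g x) (∑-mono f≤g xs)

∑-+ : (f g : A → ℕ) (xs : List A) → ∑ (λ x → f x + g x) xs ≡ ∑ f xs + ∑ g xs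
∑-+ f g []       = refl
∑-+ f g (x ∷ xs) = trans (cong (f x + g x +_) (∑-+ f g xs)) (+-+-comm (f x) (g x) _ _)
  where
  +-+-comm : ∀ a b c d → a + b + (c + d) ≡ a + c + (b + d)
  +-+-comm = solve-∀

∑-*ˡ : (c : ℕ) (f : A → ℕ) (xs : List A) → ∑ (λ x → c * f x) xs ≡ c * ∑ f xs
∑-*ˡ c f []       = sym (*-zeroʳ c)
∑-*ˡ c f (x ∷ xs) = trans (cong (c * f x +_) (∑-*ˡ c f xs)) (sym (*-distribˡ-+ c (f x) _))

∑-*ʳ : (c : ℕ) (f : A → ℕ) (xs : List A) → ∑ (λ x → f x * c) xs ≡ ∑ f xs * c
∑-*ʳ c f xs = trans (∑-cong (λ x → *-comm (f x) c) xs) (trans (∑-*ˡ c f xs) (*-comm c _))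

∑-const : (c : ℕ) (xs : List A) → ∑ (λ _ → c) xs ≡ c * length xs
∑-const c []       = sym (*-zeroʳ c)
∑-const c (x ∷ xs) = trans (cong (c +_) (∑-const c xs)) (sym (*-suc c (length xs)))

∑-map : (f : B → ℕ) (g : A → B) (xs : List A) → ∑ f (map g xs) ≡ ∑ (f ∘ g) xs
∑-map f g xs = cong sum (sym (map-∘ xs))

∑-comm : (f : A → B → ℕ) (xs : List A) (ys : List B) →
         ∑ (λ x → ∑ (f x) ys) xs ≡ ∑ (λ y → ∑ (λ x → f x y) xs) ys
∑-comm f []       ys = sym (∑-const 0 ys)
∑-comm f (x ∷ xs) ys =
  trans (cong (∑ (f x) ys +_) (∑-comm f xs ys)) (sym (∑-+ (f x) (λ y → ∑ (λ x → f x y) xs) ys))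

∑-filterᵇ : (P : A → Bool) (f : A → ℕ) (xs : List A) →
            ∑ f (filterᵇ P xs) ≡ ∑ (λ x → if P x then f x else 0) xs
∑-filterᵇ P f []       = refl
∑-filterᵇ P f (x ∷ xs) with P x
... | true  = cong (f x +_) (∑-filterᵇ P f xs)
... | false = ∑-filterᵇ P f xs

m*m≤n*n⇒m≤n : ∀ {m n} → m * m ≤ n * n → m ≤ n
m*m≤n*n⇒m≤n {m} {n} m²≤n² with m ≤? n
... | yes m≤n = m≤n
... | no  m≰n = ⊥-elim (<⇒≱ (*-mono-< (≰⇒> m≰n) (≰⇒> m≰n)) m²≤n²)

m≡0⊎n≡0 : ∀ {m n} → ¬ (1 ≤ m × 1 ≤ n) → m ≡ 0 ⊎ n ≡ 0
m≡0⊎n≡0 {zero}          _ = inj₁ refl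
m≡0⊎n≡0 {suc _} {zero}  _ = inj₂ refl
m≡0⊎n≡0 {suc _} {suc _} ¬both = ⊥-elim (¬both (s≤s z≤n , s≤s z≤n))

m+n≡∣m-n∣ : ∀ {m n} → m ≡ 0 ⊎ n ≡ 0 → m + n ≡ ∣ m - n ∣
m+n≡∣m-n∣     (inj₁ refl) = refl
m+n≡∣m-n∣ {m} (inj₂ refl) = trans (+-identityʳ m) (sym (∣-∣-identityʳ m))

≤-wlog : (P : ℕ → ℕ → Set) → (∀ a b → P a b → P b a) → (∀ a k → P a (a + k)) → ∀ a b → P a b
≤-wlog P P-sym P-+ = wlog ≤-total (P-sym _ _) λ a b a≤b →
  let (k , a+k≡b) = m≤n⇒∃[o]m+o≡n a≤b in subst (P a) a+k≡b (P-+ a k)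

am-gm : ∀ a b → 4 * (a * b) ≤ (a + b) * (a + b)
am-gm = ≤-wlog (λ a b → 4 * (a * b) ≤ (a + b) * (a + b)) flip λ a k →
  subst (4 * (a * (a + k)) ≤_) (expand a k) (m≤m+n _ (k * k))
  where
  flip : ∀ a b → 4 * (a * b) ≤ (a + b) * (a + b) → 4 * (b * a) ≤ (b + a) * (b + a)
  flip a b = subst₂ _≤_ (cong (4 *_) (*-comm a b)) (cong (λ s → s * s) (+-comm a b))
  expand : ∀ a k → 4 * (a * (a + k)) + k * k ≡ (a + (a + k)) * (a + (a + k))
  expand = solve-∀

parallelogram-law : ∀ a b → (a + b) * (a + b) + ∣ a - b ∣ * ∣ a - b ∣ ≡ 2 * (a * a + b * b)
parallelogram-law =
  ≤-wlog (λ a b → (a + b) * (a + b) + ∣ a - b ∣ * ∣ a - b ∣ ≡ 2 * (a * a + b * b)) flip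
    λ a k → trans (cong (λ d → (a + (a + k)) * (a + (a + k)) + d * d) (∣m-m+n∣≡n a k)) (expand a k)
  where
  flip : ∀ a b → (a + b) * (a + b) + ∣ a - b ∣ * ∣ a - b ∣ ≡ 2 * (a * a + b * b) →
                   (b + a) * (b + a) + ∣ b - a ∣ * ∣ b - a ∣ ≡ 2 * (b * b + a * a)
  flip a b rewrite +-comm b a | ∣-∣-comm b a | +-comm (b * b) (a * a) = id
  expand : ∀ a k → (a + (a + k)) * (a + (a + k)) + k * k ≡ 2 * (a * a + (a + k) * (a + k))
  expand = solve-∀

square-sum≤ : ∀ a b → (a + b) * (a + b) ≤ 2 * (a * a + b * b)
square-sum≤ a b = subst ((a + b) * (a + b) ≤_) (parallelogram-law a b) (m≤m+n _ _)

half-sum-square : ∀ a b c {X} → 2 * c ≤ a + b → a * a ≤ X → b * b ≤ X → c * c ≤ X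
half-sum-square a b c {X} 2c≤a+b a²≤X b²≤X = *-cancelˡ-≤ 4 (begin
  4 * (c * c)              ≡⟨ regroup c ⟩
  (2 * c) * (2 * c)        ≤⟨ *-mono-≤ 2c≤a+b 2c≤a+b ⟩
  (a + b) * (a + b)        ≤⟨ square-sum≤ a b ⟩
  2 * (a * a + b * b)      ≤⟨ *-monoʳ-≤ 2 (+-mono-≤ a²≤X b²≤X) ⟩
  2 * (X + X)              ≡⟨ double X ⟩
  4 * X                    ∎)
  where
  open ≤-Reasoning
  regroup : ∀ c → 4 * (c * c) ≡ (2 * c) * (2 * c)
  regroup = solve-∀
  double : ∀ x → 2 * (x + x) ≡ 4 * x
  double = solve-∀

cauchy-schwarz-step : ∀ n t d e → d * d ≤ n * e → (t + d) * (t + d) ≤ suc n * (t * t + e)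
cauchy-schwarz-step n t d e d²≤ne = begin
  (t + d) * (t + d)                 ≡⟨ expand t d ⟩
  t * t + 2 * (t * d) + d * d       ≤⟨ +-mono-≤ (+-monoʳ-≤ (t * t) cross≤) d²≤ne ⟩
  t * t + (n * (t * t) + e) + n * e ≡⟨ collect n t e ⟩
  suc n * (t * t + e)               ∎
  where
  open ≤-Reasoning
  expand : ∀ t d → (t + d) * (t + d) ≡ t * t + 2 * (t * d) + d * d
  expand = solve-∀
  collect : ∀ n t e → t * t + (n * (t * t) + e) + n * e ≡ suc n * (t * t + e)
  collect = solve-∀
  cross≤ : 2 * (t * d) ≤ n * (t * t) + e
  cross≤ = m*m≤n*n⇒m≤n (begin
    2 * (t * d) * (2 * (t * d))           ≡⟨ regroup₁ t d ⟩
    4 * (t * t) * (d * d)                 ≤⟨ *-monoʳ-≤ (4 * (t * t)) d²≤ne ⟩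
    4 * (t * t) * (n * e)                 ≡⟨ regroup₂ n t e ⟩
    4 * (n * (t * t) * e)                 ≤⟨ am-gm (n * (t * t)) e ⟩
    (n * (t * t) + e) * (n * (t * t) + e) ∎)
    where
    regroup₁ : ∀ t d → 2 * (t * d) * (2 * (t * d)) ≡ 4 * (t * t) * (d * d)
    regroup₁ = solve-∀
    regroup₂ : ∀ n t e → 4 * (t * t) * (n * e) ≡ 4 * (n * (t * t) * e)
    regroup₂ = solve-∀

cauchy-schwarz : (f : A → ℕ) (xs : List A) →
                 ∑ f xs * ∑ f xs ≤ length xs * ∑ (λ x → f x * f x) xs
cauchy-schwarz f []       = z≤n
cauchy-schwarz f (x ∷ xs) =
  cauchy-schwarz-step (length xs) (f x) (∑ f xs) _ (cauchy-schwarz f xs)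

-- Defined through `does`, 𝟙 computes under the map′ inside the decidable equalities of vectors
-- and sums: 𝟙 ((true ∷ x) ≟ (true ∷ y)) and 𝟙 (inj₁ x ≟ inj₁ y) reduce to 𝟙 (x ≟ y).
𝟙 : {P : Set} → Dec P → ℕ
𝟙 p? = if does p? then 1 else 0

module _ {P : Set} where

  𝟙-yes : (p? : Dec P) → P → 𝟙 p? ≡ 1
  𝟙-yes p? p rewrite dec-true p? p = refl

  𝟙-no : (p? : Dec P) → ¬ P → 𝟙 p? ≡ 0
  𝟙-no p? ¬p rewrite dec-false p? ¬p = refl

  𝟙≤1 : (p? : Dec P) → 𝟙 p? ≤ 1
  𝟙≤1 (yes _) = ≤-refl
  𝟙≤1 (no  _) = z≤n

  1≤𝟙⇒ : (p? : Dec P) → 1 ≤ 𝟙 p? → P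
  1≤𝟙⇒ (yes p) _ = p

  𝟙*𝟙 : (p? : Dec P) → 𝟙 p? * 𝟙 p? ≡ 𝟙 p?
  𝟙*𝟙 (yes _) = refl
  𝟙*𝟙 (no  _) = refl

𝟙-× : {P Q : Set} (p? : Dec P) (q? : Dec Q) → 𝟙 (p? ×-dec q?) ≡ 𝟙 p? * 𝟙 q?
𝟙-× (yes _) q? = sym (+-identityʳ (𝟙 q?))
𝟙-× (no  _) q? = refl

𝟙-sym : (_≟_ : DecidableEquality A) (x y : A) → 𝟙 (x ≟ y) ≡ 𝟙 (y ≟ x)
𝟙-sym _≟_ x y with x ≟ y
... | yes refl = sym (𝟙-yes (x ≟ x) refl)
... | no  x≢y  = sym (𝟙-no (y ≟ x) (x≢y ∘ sym))

𝟙-not : ∀ c d → 𝟙 (not c Bool.≟ d) + 𝟙 (c Bool.≟ d) ≡ 1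
𝟙-not false false = refl
𝟙-not false true  = refl
𝟙-not true  false = refl
𝟙-not true  true  = refl

module Multiplicity {A : Set} (_≟_ : DecidableEquality A) where

  count : A → List A → ℕ
  count x = ∑ (λ y → 𝟙 (y ≟ x))

  infix 4 _≋_
  _≋_ : List A → List A → Set
  xs ≋ ys = ∀ x → count x xs ≡ count x ys

  ∈⇒1≤count : ∀ {x xs} → x ∈ xs → 1 ≤ count x xs
  ∈⇒1≤count {x} (here refl) = ≤-trans (≤-reflexive (sym (𝟙-yes (x ≟ x) refl))) (m≤m+n _ _)
  ∈⇒1≤count     (there x∈xs) = ≤-trans (∈⇒1≤count x∈xs) (m≤n+m _ _)

  1≤count⇒∈ : ∀ {x} xs → 1 ≤ count x xs → x ∈ xs
  1≤count⇒∈ {x} (y ∷ xs) 1≤count with y ≟ x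
  ... | yes refl = here refl
  ... | no  _    = there (1≤count⇒∈ xs 1≤count)

  Enumerates : List A → Set
  Enumerates all = ∀ x → count x all ≡ 1

  module Enumeration (all : List A) (enumerates : Enumerates all) where

    ∈-all : ∀ x → x ∈ all
    ∈-all x = 1≤count⇒∈ all (≤-reflexive (sym (enumerates x)))

    ∑-𝟙 : ∀ x → ∑ (λ z → 𝟙 (x ≟ z)) all ≡ 1
    ∑-𝟙 x = trans (∑-cong (𝟙-sym _≟_ x) all) (enumerates x)

    ∑-select : (g : A → ℕ) (x : A) → ∑ (λ z → 𝟙 (x ≟ z) * g z) all ≡ g x
    ∑-select g x = begin
      ∑ (λ z → 𝟙 (x ≟ z) * g z) all ≡⟨ ∑-cong at-x all ⟩
      ∑ (λ z → 𝟙 (x ≟ z) * g x) all ≡⟨ ∑-*ʳ (g x) (λ z → 𝟙 (x ≟ z)) all ⟩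
      ∑ (λ z → 𝟙 (x ≟ z)) all * g x ≡⟨ cong (_* g x) (∑-𝟙 x) ⟩
      1 * g x                       ≡⟨ *-identityˡ (g x) ⟩
      g x                           ∎
      where
      open ≡-Reasoning
      at-x : ∀ z → 𝟙 (x ≟ z) * g z ≡ 𝟙 (x ≟ z) * g x
      at-x z with x ≟ z
      ... | yes refl = refl
      ... | no  _    = refl

    ∑-by-count : (f : A → ℕ) (xs : List A) → ∑ f xs ≡ ∑ (λ z → count z xs * f z) all
    ∑-by-count f xs = sym (begin
      ∑ (λ z → count z xs * f z) all
        ≡⟨ ∑-cong (λ z → sym (∑-*ʳ (f z) (λ y → 𝟙 (y ≟ z)) xs)) all ⟩
      ∑ (λ z → ∑ (λ y → 𝟙 (y ≟ z) * f z) xs) all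
        ≡⟨ ∑-comm (λ z y → 𝟙 (y ≟ z) * f z) all xs ⟩
      ∑ (λ y → ∑ (λ z → 𝟙 (y ≟ z) * f z) all) xs
        ≡⟨ ∑-cong (∑-select f) xs ⟩
      ∑ f xs
        ∎)
      where open ≡-Reasoning

    ∑-count : (xs : List A) → ∑ (λ z → count z xs) all ≡ length xs
    ∑-count xs = begin
      ∑ (λ z → count z xs) all     ≡⟨ ∑-cong (λ z → sym (*-identityʳ (count z xs))) all ⟩
      ∑ (λ z → count z xs * 1) all ≡⟨ ∑-by-count (λ _ → 1) xs ⟨
      ∑ (λ _ → 1) xs               ≡⟨ ∑-const 1 xs ⟩
      1 * length xs                ≡⟨ *-identityˡ (length xs) ⟩
      length xs                    ∎
      where open ≡-Reasoning

    ∑-≋ : (f : A → ℕ) {xs ys : List A} → xs ≋ ys → ∑ f xs ≡ ∑ f ys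
    ∑-≋ f {xs} {ys} xs≋ys = begin
      ∑ f xs                                 ≡⟨ ∑-by-count f xs ⟩
      ∑ (λ z → count z xs * f z) all         ≡⟨ ∑-cong (λ z → cong (_* f z) (xs≋ys z)) all ⟩
      ∑ (λ z → count z ys * f z) all         ≡⟨ ∑-by-count f ys ⟨
      ∑ f ys                                 ∎
      where open ≡-Reasoning

module Partner {A : Set} (_≟_ : DecidableEquality A) where

  open Multiplicity _≟_

  partner : List (A × A) → A → A
  partner []            x = x
  partner ((a , b) ∷ P) x = if does (a ≟ x) then b else partner P x

  partner-∈ : ∀ P {x} → 1 ≤ count x (map proj₁ P) → (x , partner P x) ∈ P
  partner-∈ ((a , b) ∷ P) {x} 1≤count with a ≟ x
  ... | yes refl = here refl
  ... | no  _    = there (partner-∈ P 1≤count)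

  partner-unique : ∀ P {x y} → count x (map proj₁ P) ≤ 1 → (x , y) ∈ P → partner P x ≡ y
  partner-unique ((a , b) ∷ P) {x} count≤1 xy∈ with a ≟ x | xy∈
  ... | yes refl | here refl  = refl
  ... | yes refl | there xy∈P =
    ⊥-elim (<⇒≱ (+-monoʳ-≤ 1 (∈⇒1≤count (∈-map⁺ proj₁ xy∈P))) count≤1)
  ... | no  a≢x  | here refl  = ⊥-elim (a≢x refl)
  ... | no  _    | there xy∈P = partner-unique P count≤1 xy∈P

-- End-colourings of multigraphs

module EndColouring {V : Set} (_≟_ : DecidableEquality V)
                    (vertices : List V) (enumerates : Multiplicity.Enumerates _≟_ vertices) where

  open Multiplicity _≟_
  open Enumeration vertices enumerates

  Edge : Set
  Edge = V × V

  ColouredEdge : Set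
  ColouredEdge = (V × Bool) × (V × Bool)

  uncolour : ColouredEdge → Edge
  uncolour ((a , _) , (b , _)) = a , b

  incidence : V → Edge → ℕ
  incidence v (a , b) = 𝟙 (a ≟ v) + 𝟙 (b ≟ v)

  degree : List Edge → V → ℕ
  degree E v = ∑ (incidence v) E

  endsAt : Bool → V → ColouredEdge → ℕ
  endsAt c v ((a , ca) , (b , cb)) = 𝟙 (a ≟ v) * 𝟙 (ca Bool.≟ c) + 𝟙 (b ≟ v) * 𝟙 (cb Bool.≟ c)

  ends : Bool → V → List ColouredEdge → ℕ
  ends c v = ∑ (endsAt c v)

  monochromatic : ColouredEdge → ℕ
  monochromatic ((_ , ca) , (_ , cb)) = 𝟙 (ca Bool.≟ cb)

  Degrees : List Edge → (V → ℕ) → (V → ℕ) → Set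
  Degrees E p q = ∀ v → p v + q v ≡ degree E v

  discrepancy : (V → ℕ) → (V → ℕ) → ℕ
  discrepancy p q = ∑ (λ v → ∣ p v - q v ∣) vertices

  record Colouring (E : List Edge) (p q : V → ℕ) : Set where
    field
      coloured            : List ColouredEdge
      uncolours           : map uncolour coloured ↭ E
      false-ends          : ∀ v → ends false v coloured ≡ p v
      monochromatic-bound : 2 * ∑ monochromatic coloured ≤ discrepancy p q

  open Colouring

  ends-false+true : ∀ v CE → ends false v CE + ends true v CE ≡ degree (map uncolour CE) v
  ends-false+true v CE = begin
    ends false v CE + ends true v CE                 ≡⟨ ∑-+ (endsAt false v) (endsAt true v) CE ⟨
    ∑ (λ ce → endsAt false v ce + endsAt true v ce) CE ≡⟨ ∑-cong at-edge CE ⟩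
    ∑ (incidence v ∘ uncolour) CE                    ≡⟨ ∑-map (incidence v) uncolour CE ⟨
    degree (map uncolour CE) v                       ∎
    where
    open ≡-Reasoning
    one-colour : ∀ c → 𝟙 (c Bool.≟ false) + 𝟙 (c Bool.≟ true) ≡ 1
    one-colour false = refl
    one-colour true  = refl
    regroup : ∀ x y z u w t → x * y + u * w + (x * z + u * t) ≡ x * (y + z) + u * (w + t)
    regroup = solve-∀
    at-edge : ∀ ce → endsAt false v ce + endsAt true v ce ≡ incidence v (uncolour ce)
    at-edge ((a , ca) , (b , cb)) = trans (regroup (𝟙 (a ≟ v)) _ _ (𝟙 (b ≟ v)) _ _)
      (cong₂ _+_ (trans (cong (𝟙 (a ≟ v) *_) (one-colour ca)) (*-identityʳ (𝟙 (a ≟ v))))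
                 (trans (cong (𝟙 (b ≟ v) *_) (one-colour cb)) (*-identityʳ (𝟙 (b ≟ v)))))

  true-ends : ∀ {E p q} → Degrees E p q → (C : Colouring E p q) → ∀ v → ends true v (coloured C) ≡ q v
  true-ends {E} {p} {q} degrees C v = +-cancelˡ-≡ (p v) _ _ (begin
    p v + ends true v (coloured C)                       ≡⟨ cong (_+ _) (false-ends C v) ⟨
    ends false v (coloured C) + ends true v (coloured C) ≡⟨ ends-false+true v (coloured C) ⟩
    degree (map uncolour (coloured C)) v                 ≡⟨ ∑-↭ (incidence v) (uncolours C) ⟩
    degree E v                                           ≡⟨ degrees v ⟨
    p v + q v                                            ∎)
    where open ≡-Reasoning

  ∑-degree : (E : List Edge) → ∑ (degree E) vertices ≡ 2 * length E
  ∑-degree E = begin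
    ∑ (degree E) vertices                         ≡⟨ ∑-comm (λ v e → incidence v e) vertices E ⟩
    ∑ (λ e → ∑ (λ v → incidence v e) vertices) E ≡⟨ ∑-cong two-ends E ⟩
    ∑ (λ _ → 2) E                                 ≡⟨ ∑-const 2 E ⟩
    2 * length E                                  ∎
    where
    open ≡-Reasoning
    two-ends : ∀ e → ∑ (λ v → incidence v e) vertices ≡ 2
    two-ends (a , b) =
      trans (∑-+ (λ v → 𝟙 (a ≟ v)) (λ v → 𝟙 (b ≟ v)) vertices) (cong₂ _+_ (∑-𝟙 a) (∑-𝟙 b))

  mixed-or-pure : (p q : V → ℕ) → (Σ V λ v → 1 ≤ p v × 1 ≤ q v) ⊎ (∀ v → p v ≡ 0 ⊎ q v ≡ 0)
  mixed-or-pure p q with any? (λ v → 1 ≤? p v ×-dec 1 ≤? q v) vertices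
  ... | yes mixed = inj₁ (satisfied mixed)
  ... | no  ¬mixed = inj₂ λ v → m≡0⊎n≡0 (¬mixed ∘ lose (∈-all v))

  colourBy : (V → Bool) → Edge → ColouredEdge
  colourBy tint (a , b) = (a , tint a) , (b , tint b)

  ends-colourBy : ∀ tint c v E →
                  ends c v (map (colourBy tint) E) ≡ 𝟙 (tint v Bool.≟ c) * degree E v
  ends-colourBy tint c v E = begin
    ends c v (map (colourBy tint) E)                 ≡⟨ ∑-map (endsAt c v) (colourBy tint) E ⟩
    ∑ (endsAt c v ∘ colourBy tint) E                 ≡⟨ ∑-cong at-edge E ⟩
    ∑ (λ e → 𝟙 (tint v Bool.≟ c) * incidence v e) E ≡⟨ ∑-*ˡ (𝟙 (tint v Bool.≟ c)) (incidence v) E ⟩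
    𝟙 (tint v Bool.≟ c) * degree E v                 ∎
    where
    open ≡-Reasoning
    at-end : ∀ a → 𝟙 (a ≟ v) * 𝟙 (tint a Bool.≟ c) ≡ 𝟙 (tint v Bool.≟ c) * 𝟙 (a ≟ v)
    at-end a with a ≟ v
    ... | yes refl = *-comm 1 _
    ... | no  _    = sym (*-zeroʳ (𝟙 (tint v Bool.≟ c)))
    at-edge : ∀ e → endsAt c v (colourBy tint e) ≡ 𝟙 (tint v Bool.≟ c) * incidence v e
    at-edge (a , b) =
      trans (cong₂ _+_ (at-end a) (at-end b)) (sym (*-distribˡ-+ (𝟙 (tint v Bool.≟ c)) _ _))

  monochromatic≤length : ∀ CE → ∑ monochromatic CE ≤ length CE
  monochromatic≤length []                         = z≤n
  monochromatic≤length (((_ , ca) , (_ , cb)) ∷ CE) = +-mono-≤ (𝟙≤1 (ca Bool.≟ cb)) (monochromatic≤length CE)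

  -- If p or q vanishes at every vertex, colour all ends at a vertex alike: every edge may be
  -- monochromatic, but by the handshake lemma 2 |E| = Σ deg = Σ ∣ p - q ∣.
  colour-pure : ∀ {E p q} → Degrees E p q → (∀ v → p v ≡ 0 ⊎ q v ≡ 0) → Colouring E p q
  colour-pure {E} {p} {q} degrees pure = record
    { coloured            = CE
    ; uncolours           = ↭-reflexive (trans (sym (map-∘ E)) (map-id E))
    ; false-ends          = false-ends-tint
    ; monochromatic-bound = begin
        2 * ∑ monochromatic CE ≤⟨ *-monoʳ-≤ 2 (monochromatic≤length CE) ⟩
        2 * length CE          ≡⟨ cong (2 *_) (length-map (colourBy tint) E) ⟩
        2 * length E           ≡⟨ ∑-degree E ⟨
        ∑ (degree E) vertices  ≡⟨ ∑-cong (λ v → trans (sym (degrees v)) (m+n≡∣m-n∣ (pure v))) vertices ⟩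
        discrepancy p q        ∎
    }
    where
    open ≤-Reasoning
    tint : V → Bool
    tint v = [ const true , const false ]′ (pure v)
    CE : List ColouredEdge
    CE = map (colourBy tint) E
    false-ends-tint : ∀ v → ends false v CE ≡ p v
    false-ends-tint v with pure v | ends-colourBy tint false v E
    ... | inj₁ p≡0 | ends≡ = trans ends≡ (sym p≡0)
    ... | inj₂ q≡0 | ends≡ = trans ends≡ (trans (+-identityʳ _)
                               (trans (sym (degrees v)) (trans (cong (p v +_) q≡0) (+-identityʳ (p v)))))

  data Incident (v : V) : Edge → Set where
    first  : ∀ w → Incident v (v , w)
    second : ∀ w → Incident v (w , v)

  other : ∀ {v e} → Incident v e → V
  other (first w)  = w
  other (second w) = w

  paint : ∀ {v e} → Incident v e → (at-v at-other : Bool) → ColouredEdge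
  paint {v} (first w)  cv cw = (v , cv) , (w , cw)
  paint {v} (second w) cv cw = (w , cw) , (v , cv)

  uncolour-paint : ∀ {v e} (i : Incident v e) cv cw → uncolour (paint i cv cw) ≡ e
  uncolour-paint (first  _) _ _ = refl
  uncolour-paint (second _) _ _ = refl

  incidence-incident : ∀ {v e} (i : Incident v e) u →
                       incidence u e ≡ 𝟙 (v ≟ u) + 𝟙 (other i ≟ u)
  incidence-incident     (first  _) u = refl
  incidence-incident {v} (second w) u = +-comm (𝟙 (w ≟ u)) (𝟙 (v ≟ u))

  endsAt-paint : ∀ {v e} (i : Incident v e) cv cw c u →
    endsAt c u (paint i cv cw) ≡ 𝟙 (v ≟ u) * 𝟙 (cv Bool.≟ c) + 𝟙 (other i ≟ u) * 𝟙 (cw Bool.≟ c)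
  endsAt-paint (first  _) cv cw c u = refl
  endsAt-paint (second w) cv cw c u = +-comm (𝟙 (w ≟ u) * 𝟙 (cw Bool.≟ c)) _

  monochromatic-paint : ∀ {v e} (i : Incident v e) cv cw →
                        monochromatic (paint i cv cw) ≡ 𝟙 (cv Bool.≟ cw)
  monochromatic-paint (first  _) cv cw = refl
  monochromatic-paint (second _) cv cw = 𝟙-sym Bool._≟_ cw cv

  incident-edge : ∀ {v} E → 1 ≤ degree E v →
                  Σ Edge λ e → Incident v e × Σ (List Edge) λ R → E ↭ e ∷ R
  incident-edge {v} ((a , b) ∷ E) 1≤deg with a ≟ v | b ≟ v
  ... | yes refl | _        = (v , b) , first b , E , ↭-refl
  ... | no _     | yes refl = (a , v) , second a , E , ↭-refl
  ... | no _     | no _     =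
    let e , i , R , E↭ = incident-edge E 1≤deg
    in  e , i , (a , b) ∷ R , ↭-trans (↭-prep (a , b) E↭) (↭-swap (a , b) e ↭-refl)

  loop : ∀ {v e} → 2 ≤ incidence v e → e ≡ (v , v)
  loop {v} {a , b} 2≤inc with a ≟ v | b ≟ v | 2≤inc
  ... | yes refl | yes refl | _       = refl
  ... | yes _    | no _     | s≤s ()
  ... | no _     | yes _    | s≤s ()
  ... | no _     | no _     | ()

  module _ {v e₁ e₂} (i₁ : Incident v e₁) (i₂ : Incident v e₂) (c₁ c₂ : Bool) where

    spliced : ColouredEdge
    spliced = (other i₁ , c₁) , (other i₂ , c₂)

    unspliced : List ColouredEdge
    unspliced = paint i₁ (not c₁) c₁ ∷ paint i₂ c₁ c₂ ∷ []

    uncolour-unspliced : map uncolour unspliced ≡ e₁ ∷ e₂ ∷ []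
    uncolour-unspliced =
      cong₂ (λ x y → x ∷ y ∷ []) (uncolour-paint i₁ (not c₁) c₁) (uncolour-paint i₂ c₁ c₂)

    ends-unspliced : ∀ c u → ends c u unspliced ≡ 𝟙 (v ≟ u) + endsAt c u spliced
    ends-unspliced c u = begin
      ends c u unspliced
        ≡⟨ cong₂ (λ x y → x + (y + 0)) (endsAt-paint i₁ (not c₁) c₁ c u) (endsAt-paint i₂ c₁ c₂ c u) ⟩
      (δv * γn + δa * γ₁) + ((δv * γ₁ + δb * γ₂) + 0)
        ≡⟨ regroup δv γn γ₁ δa δb γ₂ ⟩
      δv * (γn + γ₁) + (δa * γ₁ + δb * γ₂)
        ≡⟨ cong (λ k → δv * k + endsAt c u spliced) (𝟙-not c₁ c) ⟩
      δv * 1 + endsAt c u spliced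
        ≡⟨ cong (_+ endsAt c u spliced) (*-identityʳ δv) ⟩
      δv + endsAt c u spliced
        ∎
      where
      open ≡-Reasoning
      δv = 𝟙 (v ≟ u)
      δa = 𝟙 (other i₁ ≟ u)
      δb = 𝟙 (other i₂ ≟ u)
      γn = 𝟙 (not c₁ Bool.≟ c)
      γ₁ = 𝟙 (c₁ Bool.≟ c)
      γ₂ = 𝟙 (c₂ Bool.≟ c)
      regroup : ∀ v n c a b d → (v * n + a * c) + ((v * c + b * d) + 0) ≡ v * (n + c) + (a * c + b * d)
      regroup = solve-∀

    monochromatic-unspliced : ∑ monochromatic unspliced ≡ monochromatic spliced
    monochromatic-unspliced = begin
      monochromatic (paint i₁ (not c₁) c₁) + (monochromatic (paint i₂ c₁ c₂) + 0)
        ≡⟨ cong₂ (λ x y → x + (y + 0))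
                 (monochromatic-paint i₁ (not c₁) c₁) (monochromatic-paint i₂ c₁ c₂) ⟩
      𝟙 (not c₁ Bool.≟ c₁) + (𝟙 (c₁ Bool.≟ c₂) + 0)
        ≡⟨ cong₂ _+_ (not-self c₁) (+-identityʳ _) ⟩
      monochromatic spliced ∎
      where
      open ≡-Reasoning
      not-self : ∀ c → 𝟙 (not c Bool.≟ c) ≡ 0
      not-self false = refl
      not-self true  = refl

  lower : (V → ℕ) → V → V → ℕ
  lower p v u = p u ∸ 𝟙 (v ≟ u)

  lower-spec : ∀ p {v} → 1 ≤ p v → ∀ u → p u ≡ 𝟙 (v ≟ u) + lower p v u
  lower-spec p {v} 1≤pv u with v ≟ u
  ... | yes refl = sym (m+[n∸m]≡n 1≤pv)
  ... | no  _    = refl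

  degree-splice : ∀ {v e₁ e₂ E R} (i₁ : Incident v e₁) (i₂ : Incident v e₂) → E ↭ e₁ ∷ e₂ ∷ R →
                  ∀ u → degree E u ≡ 𝟙 (v ≟ u) + 𝟙 (v ≟ u) + degree ((other i₁ , other i₂) ∷ R) u
  degree-splice {v} {e₁} {e₂} {E} {R} i₁ i₂ E↭ u = begin
    degree E u
      ≡⟨ ∑-↭ (incidence u) E↭ ⟩
    incidence u e₁ + (incidence u e₂ + degree R u)
      ≡⟨ cong₂ (λ x y → x + (y + degree R u)) (incidence-incident i₁ u) (incidence-incident i₂ u) ⟩
    (𝟙 (v ≟ u) + 𝟙 (other i₁ ≟ u)) + ((𝟙 (v ≟ u) + 𝟙 (other i₂ ≟ u)) + degree R u)
      ≡⟨ shuffle (𝟙 (v ≟ u)) _ _ _ ⟩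
    𝟙 (v ≟ u) + 𝟙 (v ≟ u) + degree ((other i₁ , other i₂) ∷ R) u
      ∎
    where
    open ≡-Reasoning
    shuffle : ∀ x y z w → (x + y) + ((x + z) + w) ≡ x + x + ((y + z) + w)
    shuffle = solve-∀

  module _ {p q : V → ℕ} {v : V} (1≤pv : 1 ≤ p v) (1≤qv : 1 ≤ q v) where

    discrepancy-lower : discrepancy (lower p v) (lower q v) ≡ discrepancy p q
    discrepancy-lower = ∑-cong (λ u → trans (sym (∣m+n-m+o∣≡∣n-o∣ (𝟙 (v ≟ u)) _ _))
      (sym (cong₂ ∣_-_∣ (lower-spec p 1≤pv u) (lower-spec q 1≤qv u)))) vertices

    degrees-lower : ∀ {E E'} → Degrees E p q →
                    (∀ u → degree E u ≡ 𝟙 (v ≟ u) + 𝟙 (v ≟ u) + degree E' u) →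
                    Degrees E' (lower p v) (lower q v)
    degrees-lower {E} {E'} degrees split u = +-cancelˡ-≡ (𝟙 (v ≟ u) + 𝟙 (v ≟ u)) _ _ (begin
      𝟙 (v ≟ u) + 𝟙 (v ≟ u) + (lower p v u + lower q v u)
        ≡⟨ interchange (𝟙 (v ≟ u)) _ _ ⟩
      (𝟙 (v ≟ u) + lower p v u) + (𝟙 (v ≟ u) + lower q v u)
        ≡⟨ cong₂ _+_ (lower-spec p 1≤pv u) (lower-spec q 1≤qv u) ⟨
      p u + q u
        ≡⟨ degrees u ⟩
      degree E u
        ≡⟨ split u ⟩
      𝟙 (v ≟ u) + 𝟙 (v ≟ u) + degree E' u
        ∎)
      where
      open ≡-Reasoning
      interchange : ∀ a b c → a + a + (b + c) ≡ (a + b) + (a + c)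
      interchange = solve-∀

    extend-colouring : ∀ {E E'} (C' : Colouring E' (lower p v) (lower q v)) →
                       (CE : List ColouredEdge) → map uncolour CE ↭ E →
                       (∀ u → ends false u CE ≡ 𝟙 (v ≟ u) + ends false u (coloured C')) →
                       ∑ monochromatic CE ≡ ∑ monochromatic (coloured C') → Colouring E p q
    extend-colouring C' CE uncolours-CE ends-CE monochromatic-CE = record
      { coloured            = CE
      ; uncolours           = uncolours-CE
      ; false-ends          = λ u → trans (ends-CE u)
                                (trans (cong (𝟙 (v ≟ u) +_) (false-ends C' u)) (sym (lower-spec p 1≤pv u)))
      ; monochromatic-bound = subst₂ _≤_ (cong (2 *_) (sym monochromatic-CE)) discrepancy-lower
                                (monochromatic-bound C')
      }

    colour-loop : ∀ {E R} → Degrees E p q → E ↭ (v , v) ∷ R →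
                  (Degrees R (lower p v) (lower q v) → Colouring R (lower p v) (lower q v)) → Colouring E p q
    colour-loop {E} {R} degrees E↭ colour-R =
      extend-colouring C' (((v , false) , (v , true)) ∷ coloured C')
        (↭-trans (↭-prep (v , v) (uncolours C')) (↭-sym E↭))
        (λ u → cong (_+ ends false u (coloured C')) (at-v (𝟙 (v ≟ u))))
        refl
      where
      C' = colour-R (degrees-lower {E} {R} degrees λ u → ∑-↭ (incidence u) E↭)
      at-v : ∀ x → x * 1 + x * 0 ≡ x
      at-v = solve-∀

    -- Two edges e₁ = {v, a}, e₂ = {v, b} are spliced into {a, b}; undoing the splice, the two
    -- ends at v get different colours and e₁ becomes bichromatic.
    colour-splice : ∀ {E e₁ e₂ R} (i₁ : Incident v e₁) (i₂ : Incident v e₂) →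
                    Degrees E p q → E ↭ e₁ ∷ e₂ ∷ R →
                    (Degrees ((other i₁ , other i₂) ∷ R) (lower p v) (lower q v) →
                     Colouring ((other i₁ , other i₂) ∷ R) (lower p v) (lower q v)) →
                    Colouring E p q
    colour-splice {E} {e₁} {e₂} {R} i₁ i₂ degrees E↭ colour-spliced
      with C' ← colour-spliced
                  (degrees-lower {E} {(other i₁ , other i₂) ∷ R} degrees (degree-splice i₁ i₂ E↭))
      with ↭-map-inv uncolour (uncolours C')
    ... | ((_ , c₁) , (_ , c₂)) ∷ CR , refl , C'↭ =
      extend-colouring C' (U ++ CR) uncolours-CE ends-CE
        (trans (∑-++ monochromatic U CR)
               (trans (cong (_+ ∑ monochromatic CR) (monochromatic-unspliced i₁ i₂ c₁ c₂))
                      (∑-↭ monochromatic (↭-sym C'↭))))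
      where
      U = unspliced i₁ i₂ c₁ c₂
      uncolours-CE : map uncolour (U ++ CR) ↭ E
      uncolours-CE = ↭-trans (↭-reflexive (trans (map-++ uncolour U CR)
                                 (cong (_++ map uncolour CR) (uncolour-unspliced i₁ i₂ c₁ c₂)))) (↭-sym E↭)
      ends-CE : ∀ u → ends false u (U ++ CR) ≡ 𝟙 (v ≟ u) + ends false u (coloured C')
      ends-CE u = begin
        ends false u (U ++ CR)
          ≡⟨ ∑-++ (endsAt false u) U CR ⟩
        ends false u U + ends false u CR
          ≡⟨ cong (_+ ends false u CR) (ends-unspliced i₁ i₂ c₁ c₂ false u) ⟩
        𝟙 (v ≟ u) + endsAt false u (spliced i₁ i₂ c₁ c₂) + ends false u CR
          ≡⟨ +-assoc (𝟙 (v ≟ u)) _ _ ⟩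
        𝟙 (v ≟ u) + ends false u (spliced i₁ i₂ c₁ c₂ ∷ CR)
          ≡⟨ cong (𝟙 (v ≟ u) +_) (∑-↭ (endsAt false u) (↭-sym C'↭)) ⟩
        𝟙 (v ≟ u) + ends false u (coloured C')
          ∎
        where open ≡-Reasoning

  lone-edge-is-loop : ∀ {E e R p q v} → Degrees E p q → 1 ≤ p v → 1 ≤ q v → E ↭ e ∷ R →
                      ¬ 1 ≤ degree R v → e ≡ (v , v)
  lone-edge-is-loop {E} {e} {R} {p} {q} {v} degrees 1≤pv 1≤qv E↭ no-more = loop (begin
    2                               ≤⟨ +-mono-≤ 1≤pv 1≤qv ⟩
    p v + q v                       ≡⟨ degrees v ⟩
    degree E v                      ≡⟨ ∑-↭ (incidence v) E↭ ⟩
    incidence v e + degree R v      ≡⟨ cong (incidence v e +_) (n≤0⇒n≡0 (≮⇒≥ no-more)) ⟩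
    incidence v e + 0               ≡⟨ +-identityʳ _ ⟩
    incidence v e                   ∎)
    where open ≤-Reasoning

  colour : ∀ k E p q → length E ≡ k → Degrees E p q → Colouring E p q
  colour k E p q len degrees with mixed-or-pure p q
  ... | inj₂ pure = colour-pure degrees pure
  ... | inj₁ (v , 1≤pv , 1≤qv)
    with e₁ , i₁ , R₁ , E↭ ← incident-edge E (≤-trans 1≤pv (≤-trans (m≤m+n _ _) (≤-reflexive (degrees v))))
    with k | 1 ≤? degree R₁ v
  ... | zero  | _          = ⊥-elim (1+n≢0 (trans (sym (↭-length E↭)) len))
  ... | suc k | no  ¬more
    with refl ← lone-edge-is-loop {p = p} {q} degrees 1≤pv 1≤qv E↭ ¬more =
    colour-loop 1≤pv 1≤qv degrees E↭ (colour k R₁ _ _ length-R₁)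
    where
    length-R₁ : length R₁ ≡ k
    length-R₁ = suc-injective (trans (sym (↭-length E↭)) len)
  ... | suc k | yes more
    with e₂ , i₂ , R , R₁↭ ← incident-edge R₁ more =
    colour-splice 1≤pv 1≤qv i₁ i₂ degrees (↭-trans E↭ (↭-prep e₁ R₁↭)) (colour k _ _ _ length-spliced)
    where
    length-spliced : suc (length R) ≡ k
    length-spliced = trans (sym (↭-length R₁↭)) (suc-injective (trans (sym (↭-length E↭)) len))

  colouring : ∀ {E p q} → Degrees E p q → Colouring E p q
  colouring {E} = colour (length E) E _ _ refl

_≟ᶜ_ : ∀ {n} → DecidableEquality (Cube n)
_≟ᶜ_ = Vec.≡-dec Bool._≟_

open module CubeMultiplicity {n : ℕ} = Multiplicity (_≟ᶜ_ {n})
open module CubePartner {n : ℕ} = Partner (_≟ᶜ_ {n})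

private variable n : ℕ

∑-allCube : ∀ n (f : Cube (suc n) → ℕ) →
            ∑ f (allCube (suc n)) ≡ ∑ (λ x → f (false ∷ x) + f (true ∷ x)) (allCube n)
∑-allCube n f = begin
  ∑ f (map (false ∷_) (allCube n) ++ map (true ∷_) (allCube n))
    ≡⟨ ∑-++ f (map (false ∷_) (allCube n)) (map (true ∷_) (allCube n)) ⟩
  ∑ f (map (false ∷_) (allCube n)) + ∑ f (map (true ∷_) (allCube n))
    ≡⟨ cong₂ _+_ (∑-map f (false ∷_) (allCube n)) (∑-map f (true ∷_) (allCube n)) ⟩
  ∑ (λ x → f (false ∷ x)) (allCube n) + ∑ (λ x → f (true ∷ x)) (allCube n)
    ≡⟨ ∑-+ (λ x → f (false ∷ x)) (λ x → f (true ∷ x)) (allCube n) ⟨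
  ∑ (λ x → f (false ∷ x) + f (true ∷ x)) (allCube n)
    ∎
  where open ≡-Reasoning

allCube-enumerates : ∀ n → Enumerates (allCube n)
allCube-enumerates zero    []      = refl
allCube-enumerates (suc n) (b ∷ x) =
  trans (∑-allCube n (λ y → 𝟙 (y ≟ᶜ (b ∷ x))))
        (trans (∑-cong (first-bit b) (allCube n)) (allCube-enumerates n x))
  where
  first-bit : ∀ b y → 𝟙 ((false ∷ y) ≟ᶜ (b ∷ x)) + 𝟙 ((true ∷ y) ≟ᶜ (b ∷ x)) ≡ 𝟙 (y ≟ᶜ x)
  first-bit false y = +-identityʳ _
  first-bit true  y = refl

length-allCube : ∀ n → length (allCube n) ≡ 2 ^ n
length-allCube zero    = refl
length-allCube (suc n) = begin
  length (map (false ∷_) (allCube n) ++ map (true ∷_) (allCube n))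
    ≡⟨ length-++ (map (false ∷_) (allCube n)) ⟩
  length (map (false ∷_) (allCube n)) + length (map (true ∷_) (allCube n))
    ≡⟨ cong₂ _+_ (length-map (false ∷_) (allCube n)) (length-map (true ∷_) (allCube n)) ⟩
  length (allCube n) + length (allCube n)
    ≡⟨ cong₂ _+_ (length-allCube n) (trans (length-allCube n) (sym (+-identityʳ (2 ^ n)))) ⟩
  2 ^ n + (2 ^ n + 0)
    ∎
  where open ≡-Reasoning

count-[] : (xs : List (Cube 0)) → count [] xs ≡ length xs
count-[] []        = refl
count-[] ([] ∷ xs) = cong suc (count-[] xs)

count-map-tail : (x : Cube n) (α : List (Cube (suc n))) →
                 count x (map tail α) ≡ count (false ∷ x) α + count (true ∷ x) α
count-map-tail x α = begin
  count x (map tail α)                                     ≡⟨ ∑-map (λ y → 𝟙 (y ≟ᶜ x)) tail α ⟩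
  ∑ (λ z → 𝟙 (tail z ≟ᶜ x)) α                             ≡⟨ ∑-cong by-head α ⟩
  ∑ (λ z → 𝟙 (z ≟ᶜ (false ∷ x)) + 𝟙 (z ≟ᶜ (true ∷ x))) α ≡⟨ ∑-+ _ _ α ⟩
  count (false ∷ x) α + count (true ∷ x) α                 ∎
  where
  open ≡-Reasoning
  by-head : ∀ z → 𝟙 (tail z ≟ᶜ x) ≡ 𝟙 (z ≟ᶜ (false ∷ x)) + 𝟙 (z ≟ᶜ (true ∷ x))
  by-head (false ∷ z) = sym (+-identityʳ _)
  by-head (true  ∷ z) = refl

dist-∷-not : ∀ c d (x y : Cube n) → dist (c ∷ x) (not d ∷ y) ≡ 𝟙 (c Bool.≟ d) + dist x y
dist-∷-not false false x y = refl
dist-∷-not false true  x y = refl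
dist-∷-not true  false x y = refl
dist-∷-not true  true  x y = refl

-- Couplings of multisets in the cube

Pair : ℕ → Set
Pair n = Cube n × Cube n

cost : List (Pair n) → ℕ
cost = ∑ (uncurry dist)

record Coupling (P : List (Pair n)) (α β : List (Cube n)) : Set where
  field
    marginal₁ : map proj₁ P ≋ α
    marginal₂ : map proj₂ P ≋ β

open Coupling

fibreGap : List (Cube (suc n)) → Cube n → ℕ
fibreGap α x = ∣ count (false ∷ x) α - count (true ∷ x) α ∣

fibreImbalance : (n : ℕ) → List (Cube (suc n)) → ℕ
fibreImbalance n α = ∑ (fibreGap α) (allCube n)

levelImbalances : (n : ℕ) → List (Cube n) → List ℕ
levelImbalances zero    α = []
levelImbalances (suc n) α = fibreImbalance n α ∷ levelImbalances n (map tail α)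

imbalance : (n : ℕ) → List (Cube n) → ℕ
imbalance n α = sum (levelImbalances n α)

module Lifting (n : ℕ) (α β : List (Cube (suc n))) where

  Side : Set
  Side = Cube n ⊎ Cube n

  sides : List Side
  sides = map inj₁ (allCube n) ++ map inj₂ (allCube n)

  _≟ˢ_ : DecidableEquality Side
  _≟ˢ_ = Sum.≡-dec _≟ᶜ_ _≟ᶜ_

  sides-enumerate : Multiplicity.Enumerates _≟ˢ_ sides
  sides-enumerate v = begin
    ∑ (λ y → 𝟙 (y ≟ˢ v)) (map inj₁ (allCube n) ++ map inj₂ (allCube n))
      ≡⟨ ∑-++ (λ y → 𝟙 (y ≟ˢ v)) (map inj₁ (allCube n)) (map inj₂ (allCube n)) ⟩
    ∑ (λ y → 𝟙 (y ≟ˢ v)) (map inj₁ (allCube n)) + ∑ (λ y → 𝟙 (y ≟ˢ v)) (map inj₂ (allCube n))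
      ≡⟨ cong₂ _+_ (∑-map (λ y → 𝟙 (y ≟ˢ v)) inj₁ (allCube n))
                   (∑-map (λ y → 𝟙 (y ≟ˢ v)) inj₂ (allCube n)) ⟩
    ∑ (λ x → 𝟙 (inj₁ x ≟ˢ v)) (allCube n) + ∑ (λ y → 𝟙 (inj₂ y ≟ˢ v)) (allCube n)
      ≡⟨ on-side v ⟩
    1 ∎
    where
    open ≡-Reasoning
    on-side : ∀ v →
              ∑ (λ x → 𝟙 (inj₁ x ≟ˢ v)) (allCube n) + ∑ (λ y → 𝟙 (inj₂ y ≟ˢ v)) (allCube n) ≡ 1
    on-side (inj₁ x) = trans (cong (count x (allCube n) +_) (∑-const 0 (allCube n)))
                             (trans (+-identityʳ _) (allCube-enumerates n x))
    on-side (inj₂ y) = trans (cong (_+ count y (allCube n)) (∑-const 0 (allCube n)))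
                             (allCube-enumerates n y)

  open EndColouring _≟ˢ_ sides sides-enumerate

  -- The vertex inj₁ x is the fibre {0x, 1x} of α, and inj₂ y the fibre {0y, 1y} of β.  An end
  -- coloured c at inj₁ x lifts to c ∷ x, one at inj₂ y to not c ∷ y: so an edge changes its first
  -- bit exactly when it is monochromatic.
  target : Bool → Side → ℕ
  target c (inj₁ x) = count (c ∷ x) α
  target c (inj₂ y) = count (not c ∷ y) β

  cross : Pair n → Edge
  cross (x , y) = inj₁ x , inj₂ y

  liftEdge : ColouredEdge → Pair (suc n)
  liftEdge ((a , c) , (b , d)) = c ∷ reduce a , not d ∷ reduce b

  edgeDist : Edge → ℕ
  edgeDist (a , b) = dist (reduce a) (reduce b)

  Crossing : ColouredEdge → Set
  Crossing ce = Σ (Pair n) λ xy → uncolour ce ≡ cross xy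

  discrepancy-target : discrepancy (target false) (target true) ≡ fibreImbalance n α + fibreImbalance n β
  discrepancy-target =
    trans (∑-++ gap (map inj₁ (allCube n)) (map inj₂ (allCube n)))
      (cong₂ _+_ (∑-map gap inj₁ (allCube n))
                 (trans (∑-map gap inj₂ (allCube n))
                        (∑-cong (λ y → ∣-∣-comm (count (true ∷ y) β) _) (allCube n))))
    where
    gap : Side → ℕ
    gap v = ∣ target false v - target true v ∣

  module _ {P' : List (Pair n)} (C' : Coupling P' (map tail α) (map tail β)) where

    degrees : Degrees (map cross P') (target false) (target true)
    degrees (inj₁ x) = sym (begin
      degree (map cross P') (inj₁ x)           ≡⟨ ∑-map (incidence (inj₁ x)) cross P' ⟩
      ∑ (λ e → 𝟙 (proj₁ e ≟ᶜ x) + 0) P'        ≡⟨ ∑-cong (λ e → +-identityʳ _) P' ⟩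
      ∑ (λ e → 𝟙 (proj₁ e ≟ᶜ x)) P'            ≡⟨ ∑-map (λ y → 𝟙 (y ≟ᶜ x)) proj₁ P' ⟨
      count x (map proj₁ P')                   ≡⟨ marginal₁ C' x ⟩
      count x (map tail α)                     ≡⟨ count-map-tail x α ⟩
      count (false ∷ x) α + count (true ∷ x) α ∎)
      where open ≡-Reasoning
    degrees (inj₂ y) = sym (begin
      degree (map cross P') (inj₂ y)           ≡⟨ ∑-map (incidence (inj₂ y)) cross P' ⟩
      ∑ (λ e → 𝟙 (proj₂ e ≟ᶜ y)) P'            ≡⟨ ∑-map (λ z → 𝟙 (z ≟ᶜ y)) proj₂ P' ⟨
      count y (map proj₂ P')                   ≡⟨ marginal₂ C' y ⟩
      count y (map tail β)                     ≡⟨ count-map-tail y β ⟩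
      count (false ∷ y) β + count (true ∷ y) β ≡⟨ +-comm (count (false ∷ y) β) _ ⟩
      count (true ∷ y) β + count (false ∷ y) β ∎)
      where open ≡-Reasoning

    module _ (C : Colouring (map cross P') (target false) (target true)) where

      private
        CE : List ColouredEdge
        CE = Colouring.coloured C

      ends-target : ∀ c v → ends c v CE ≡ target c v
      ends-target false = Colouring.false-ends C
      ends-target true  = true-ends degrees C

      crossing : All Crossing CE
      crossing = All.map⁻ (All-resp-↭ (↭-sym (Colouring.uncolours C))
        (All.tabulate λ e∈ → let xy , _ , e≡ = ∈-map⁻ cross e∈ in xy , e≡))

      lift-left : map proj₁ (map liftEdge CE) ≋ α
      lift-left (s ∷ x) = begin
        count (s ∷ x) (map proj₁ (map liftEdge CE))
          ≡⟨ trans (∑-map (λ z → 𝟙 (z ≟ᶜ (s ∷ x))) proj₁ (map liftEdge CE))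
                   (∑-map (λ e → 𝟙 (proj₁ e ≟ᶜ (s ∷ x))) liftEdge CE) ⟩
        ∑ (λ ce → 𝟙 (proj₁ (liftEdge ce) ≟ᶜ (s ∷ x))) CE
          ≡⟨ ∑-cong-All (All.map (λ {ce} → at-edge {ce}) crossing) ⟩
        ends s (inj₁ x) CE
          ≡⟨ ends-target s (inj₁ x) ⟩
        count (s ∷ x) α
          ∎
        where
        open ≡-Reasoning
        at-edge : ∀ {ce} → Crossing ce → 𝟙 (proj₁ (liftEdge ce) ≟ᶜ (s ∷ x)) ≡ endsAt s (inj₁ x) ce
        at-edge {(_ , c) , (_ , d)} ((x' , _) , refl) =
          trans (𝟙-× (c Bool.≟ s) (x' ≟ᶜ x)) (trans (*-comm (𝟙 (c Bool.≟ s)) _) (sym (+-identityʳ _)))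

      lift-right : map proj₂ (map liftEdge CE) ≋ β
      lift-right (s ∷ y) = begin
        count (s ∷ y) (map proj₂ (map liftEdge CE))
          ≡⟨ trans (∑-map (λ z → 𝟙 (z ≟ᶜ (s ∷ y))) proj₂ (map liftEdge CE))
                   (∑-map (λ e → 𝟙 (proj₂ e ≟ᶜ (s ∷ y))) liftEdge CE) ⟩
        ∑ (λ ce → 𝟙 (proj₂ (liftEdge ce) ≟ᶜ (s ∷ y))) CE
          ≡⟨ ∑-cong-All (All.map (λ {ce} → at-edge {ce}) crossing) ⟩
        ends (not s) (inj₂ y) CE
          ≡⟨ ends-target (not s) (inj₂ y) ⟩
        count (not (not s) ∷ y) β
          ≡⟨ cong (λ b → count (b ∷ y) β) (Bool.not-involutive s) ⟩
        count (s ∷ y) β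
          ∎
        where
        open ≡-Reasoning
        flip : ∀ d s → 𝟙 (not d Bool.≟ s) ≡ 𝟙 (d Bool.≟ not s)
        flip false false = refl
        flip false true  = refl
        flip true  false = refl
        flip true  true  = refl
        at-edge : ∀ {ce} → Crossing ce → 𝟙 (proj₂ (liftEdge ce) ≟ᶜ (s ∷ y)) ≡ endsAt (not s) (inj₂ y) ce
        at-edge {(_ , c) , (_ , d)} ((_ , y') , refl) =
          trans (𝟙-× (not d Bool.≟ s) (y' ≟ᶜ y))
                (trans (cong (_* 𝟙 (y' ≟ᶜ y)) (flip d s)) (*-comm _ (𝟙 (y' ≟ᶜ y))))

      cost-lift : cost (map liftEdge CE) ≡ ∑ monochromatic CE + cost P'
      cost-lift = begin
        cost (map liftEdge CE)
          ≡⟨ ∑-map (uncurry dist) liftEdge CE ⟩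
        ∑ (uncurry dist ∘ liftEdge) CE
          ≡⟨ ∑-cong (λ ((a , c) , (b , d)) → dist-∷-not c d (reduce a) (reduce b)) CE ⟩
        ∑ (λ ce → monochromatic ce + edgeDist (uncolour ce)) CE
          ≡⟨ ∑-+ monochromatic (edgeDist ∘ uncolour) CE ⟩
        ∑ monochromatic CE + ∑ (edgeDist ∘ uncolour) CE
          ≡⟨ cong (∑ monochromatic CE +_) (∑-map edgeDist uncolour CE) ⟨
        ∑ monochromatic CE + ∑ edgeDist (map uncolour CE)
          ≡⟨ cong (∑ monochromatic CE +_)
                  (trans (∑-↭ edgeDist (Colouring.uncolours C)) (∑-map edgeDist cross P')) ⟩
        ∑ monochromatic CE + cost P'
          ∎
        where open ≡-Reasoning

      lift-colouring : Σ (List (Pair (suc n))) λ P → Coupling P α β ×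
                         2 * cost P ≤ fibreImbalance n α + fibreImbalance n β + 2 * cost P'
      lift-colouring = map liftEdge CE , record { marginal₁ = lift-left ; marginal₂ = lift-right } , (begin
        2 * cost (map liftEdge CE)                             ≡⟨ cong (2 *_) cost-lift ⟩
        2 * (∑ monochromatic CE + cost P')                     ≡⟨ *-distribˡ-+ 2 (∑ monochromatic CE) _ ⟩
        2 * ∑ monochromatic CE + 2 * cost P'                   ≤⟨ +-monoˡ-≤ _ (Colouring.monochromatic-bound C) ⟩
        discrepancy (target false) (target true) + 2 * cost P' ≡⟨ cong (_+ 2 * cost P') discrepancy-target ⟩
        fibreImbalance n α + fibreImbalance n β + 2 * cost P'  ∎)
        where open ≤-Reasoning

    lift-coupling : Σ (List (Pair (suc n))) λ P → Coupling P α β ×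
                      2 * cost P ≤ fibreImbalance n α + fibreImbalance n β + 2 * cost P'
    lift-coupling = lift-colouring (colouring degrees)

coupling-within-imbalance : ∀ n (α β : List (Cube n)) → length α ≡ length β →
  Σ (List (Pair n)) λ P → Coupling P α β × 2 * cost P ≤ imbalance n α + imbalance n β
coupling-within-imbalance zero α β len =
  P₀ , record { marginal₁ = marginal₁′ ; marginal₂ = marginal₂′ } , ≤-reflexive (cong (2 *_) cost≡0)
  where
  P₀ : List (Pair 0)
  P₀ = map (λ _ → [] , []) α
  length-P₀ : length P₀ ≡ length α
  length-P₀ = length-map (λ _ → [] , []) α
  marginal₁′ : map proj₁ P₀ ≋ α
  marginal₁′ [] = trans (count-[] (map proj₁ P₀))
    (trans (length-map proj₁ P₀) (trans length-P₀ (sym (count-[] α))))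
  marginal₂′ : map proj₂ P₀ ≋ β
  marginal₂′ [] = trans (count-[] (map proj₂ P₀))
    (trans (length-map proj₂ P₀) (trans length-P₀ (trans len (sym (count-[] β)))))
  cost≡0 : cost P₀ ≡ 0
  cost≡0 = trans (∑-map (uncurry dist) (λ _ → [] , []) α) (∑-const 0 α)
coupling-within-imbalance (suc n) α β len =
  let P' , C' , bound' = coupling-within-imbalance n (map tail α) (map tail β) same-length
      P  , C  , bound  = Lifting.lift-coupling n α β {P'} C'
  in P , C , (begin
    2 * cost P                    ≤⟨ bound ⟩
    Fα + Fβ + 2 * cost P'         ≤⟨ +-monoʳ-≤ (Fα + Fβ) bound' ⟩
    Fα + Fβ + (Dα' + Dβ')         ≡⟨ interchange Fα Fβ Dα' Dβ' ⟩
    (Fα + Dα') + (Fβ + Dβ')       ∎)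
  where
  open ≤-Reasoning
  same-length : length (map tail α) ≡ length (map tail β)
  same-length = trans (length-map tail α) (trans len (sym (length-map tail β)))
  Fα = fibreImbalance n α
  Fβ = fibreImbalance n β
  Dα' = imbalance n (map tail α)
  Dβ' = imbalance n (map tail β)
  interchange : ∀ a b c d → a + b + (c + d) ≡ (a + c) + (b + d)
  interchange = solve-∀

-- The quadratic bound on the imbalance

collisions : (n : ℕ) → List (Cube n) → ℕ
collisions n α = ∑ (λ z → count z α * count z α) (allCube n)

collisions-map-tail : ∀ n (α : List (Cube (suc n))) →
  collisions n (map tail α) + ∑ (λ x → fibreGap α x * fibreGap α x) (allCube n) ≡ 2 * collisions (suc n) α
collisions-map-tail n α = begin
  collisions n (map tail α) + ∑ (λ x → fibreGap α x * fibreGap α x) (allCube n)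
    ≡⟨ ∑-+ (λ x → count x (map tail α) * count x (map tail α))
           (λ x → fibreGap α x * fibreGap α x) (allCube n) ⟨
  ∑ (λ x → count x (map tail α) * count x (map tail α) + fibreGap α x * fibreGap α x) (allCube n)
    ≡⟨ ∑-cong fibre (allCube n) ⟩
  ∑ (λ x → 2 * (c₀ x * c₀ x + c₁ x * c₁ x)) (allCube n)
    ≡⟨ ∑-*ˡ 2 (λ x → c₀ x * c₀ x + c₁ x * c₁ x) (allCube n) ⟩
  2 * ∑ (λ x → c₀ x * c₀ x + c₁ x * c₁ x) (allCube n)
    ≡⟨ cong (2 *_) (∑-allCube n (λ z → count z α * count z α)) ⟨
  2 * collisions (suc n) α
    ∎
  where
  open ≡-Reasoning
  c₀ c₁ : Cube n → ℕ
  c₀ x = count (false ∷ x) α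
  c₁ x = count (true ∷ x) α
  fibre : ∀ x → count x (map tail α) * count x (map tail α) + fibreGap α x * fibreGap α x
                ≡ 2 * (c₀ x * c₀ x + c₁ x * c₁ x)
  fibre x = trans (cong (λ c → c * c + fibreGap α x * fibreGap α x) (count-map-tail x α))
                  (parallelogram-law (c₀ x) (c₁ x))

levelImbalances-bound : ∀ n (α : List (Cube n)) →
  ∑ (λ t → t * t) (levelImbalances n α) + length α * length α ≤ 2 ^ n * collisions n α
levelImbalances-bound zero α =
  ≤-reflexive (trans (cong (λ c → c * c) (sym (count-[] α))) (pad (count [] α)))
  where
  pad : ∀ c → c * c ≡ 1 * (c * c + 0)
  pad = solve-∀
levelImbalances-bound (suc n) α = begin
  F * F + E' + L * L                 ≡⟨ +-assoc (F * F) E' (L * L) ⟩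
  F * F + (E' + L * L)               ≡⟨ cong (λ l → F * F + (E' + l * l)) (sym (length-map tail α)) ⟩
  F * F + (E' + L' * L')             ≤⟨ +-mono-≤ fibres (levelImbalances-bound n (map tail α)) ⟩
  2 ^ n * U + 2 ^ n * S'             ≡⟨ *-distribˡ-+ (2 ^ n) U S' ⟨
  2 ^ n * (U + S')                   ≡⟨ cong (2 ^ n *_) (trans (+-comm U S') (collisions-map-tail n α)) ⟩
  2 ^ n * (2 * collisions (suc n) α) ≡⟨ regroup (2 ^ n) (collisions (suc n) α) ⟩
  2 ^ suc n * collisions (suc n) α   ∎
  where
  open ≤-Reasoning
  F  = fibreImbalance n α
  E' = ∑ (λ t → t * t) (levelImbalances n (map tail α))
  L  = length α
  L' = length (map tail α)
  U  = ∑ (λ x → fibreGap α x * fibreGap α x) (allCube n)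
  S' = collisions n (map tail α)
  fibres : F * F ≤ 2 ^ n * U
  fibres = subst (λ k → F * F ≤ k * U) (length-allCube n) (cauchy-schwarz (fibreGap α) (allCube n))
  regroup : ∀ a s → a * (2 * s) ≡ 2 * a * s
  regroup = solve-∀

length-levelImbalances : ∀ n (α : List (Cube n)) → length (levelImbalances n α) ≡ n
length-levelImbalances zero    α = refl
length-levelImbalances (suc n) α = cong suc (length-levelImbalances n (map tail α))

imbalance-bound : ∀ n (α : List (Cube n)) →
  imbalance n α * imbalance n α + n * (length α * length α) ≤ n * (2 ^ n * collisions n α)
imbalance-bound n α = begin
  D * D + n * (L * L)          ≤⟨ +-monoˡ-≤ (n * (L * L)) D²≤nE ⟩
  n * E + n * (L * L)          ≡⟨ *-distribˡ-+ n E (L * L) ⟨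
  n * (E + L * L)              ≤⟨ *-monoʳ-≤ n (levelImbalances-bound n α) ⟩
  n * (2 ^ n * collisions n α) ∎
  where
  open ≤-Reasoning
  ls = levelImbalances n α
  D  = imbalance n α
  E  = ∑ (λ t → t * t) ls
  L  = length α
  D²≤nE : D * D ≤ n * E
  D²≤nE = subst₂ (λ d k → d * d ≤ k * E) (cong sum (map-id ls)) (length-levelImbalances n α) (cauchy-schwarz id ls)

count-elems : (A : SubsetCube n) (z : Cube n) → count z (elems A) ≡ 𝟙 (T? (A z))
count-elems {n} A z = begin
  count z (elems A)
    ≡⟨ ∑-filterᵇ A (λ y → 𝟙 (y ≟ᶜ z)) (allCube n) ⟩
  ∑ (λ x → if A x then 𝟙 (x ≟ᶜ z) else 0) (allCube n)
    ≡⟨ ∑-cong at (allCube n) ⟩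
  ∑ (λ x → 𝟙 (T? (A z)) * 𝟙 (x ≟ᶜ z)) (allCube n)
    ≡⟨ ∑-*ˡ (𝟙 (T? (A z))) (λ x → 𝟙 (x ≟ᶜ z)) (allCube n) ⟩
  𝟙 (T? (A z)) * count z (allCube n)
    ≡⟨ cong (𝟙 (T? (A z)) *_) (allCube-enumerates n z) ⟩
  𝟙 (T? (A z)) * 1
    ≡⟨ *-identityʳ _ ⟩
  𝟙 (T? (A z))
    ∎
  where
  open ≡-Reasoning
  at : ∀ x → (if A x then 𝟙 (x ≟ᶜ z) else 0) ≡ 𝟙 (T? (A z)) * 𝟙 (x ≟ᶜ z)
  at x with x ≟ᶜ z
  at x | yes refl with A x
  ... | true  = refl
  ... | false = refl
  at x | no _ with A x
  ... | true  = sym (*-zeroʳ (𝟙 (T? (A z))))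
  ... | false = sym (*-zeroʳ (𝟙 (T? (A z))))

collisions-elems : (A : SubsetCube n) → collisions n (elems A) ≡ card A
collisions-elems {n} A = begin
  ∑ (λ z → count z (elems A) * count z (elems A)) (allCube n)
    ≡⟨ ∑-cong square≡ (allCube n) ⟩
  ∑ (λ z → count z (elems A)) (allCube n)
    ≡⟨ Enumeration.∑-count (allCube n) (allCube-enumerates n) (elems A) ⟩
  card A
    ∎
  where
  open ≡-Reasoning
  square≡ : ∀ z → count z (elems A) * count z (elems A) ≡ count z (elems A)
  square≡ z rewrite count-elems A z = 𝟙*𝟙 (T? (A z))

imbalance-of-half : ∀ m (A : SubsetCube (suc m)) → card A ≡ 2 ^ m →
  imbalance (suc m) (elems A) * imbalance (suc m) (elems A) ≤ suc m * (2 ^ m * 2 ^ m)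
imbalance-of-half m A |A| = +-cancelʳ-≤ (suc m * (L * L)) (D * D) (suc m * (L * L)) (begin
  D * D + suc m * (L * L)
    ≡⟨ cong (λ c → D * D + suc m * (c * c)) (sym |A|) ⟩
  D * D + suc m * (card A * card A)
    ≤⟨ imbalance-bound (suc m) (elems A) ⟩
  suc m * (2 ^ suc m * collisions (suc m) (elems A))
    ≡⟨ cong (λ c → suc m * (2 ^ suc m * c)) (trans (collisions-elems A) |A|) ⟩
  suc m * (2 * L * L)
    ≡⟨ double (suc m) L ⟩
  suc m * (L * L) + suc m * (L * L)
    ∎)
  where
  open ≤-Reasoning
  D = imbalance (suc m) (elems A)
  L = 2 ^ m
  double : ∀ k l → k * (2 * l * l) ≡ k * (l * l) + k * (l * l)
  double = solve-∀

module _ (A B : SubsetCube n) (P : List (Pair n)) (C : Coupling P (elems A) (elems B)) where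

  open Enumeration (allCube n) (allCube-enumerates n) using (∑-≋)

  private
    count-left : ∀ x → count x (map proj₁ P) ≡ 𝟙 (T? (A x))
    count-left x = trans (marginal₁ C x) (count-elems A x)

    count-right : ∀ y → count y (map proj₂ P) ≡ 𝟙 (T? (B y))
    count-right y = trans (marginal₂ C y) (count-elems B y)

    left≤1 : ∀ x → count x (map proj₁ P) ≤ 1
    left≤1 x = subst (_≤ 1) (sym (count-left x)) (𝟙≤1 (T? (A x)))

    right≤1 : ∀ y → count y (map proj₁ (map swap P)) ≤ 1
    right≤1 y = subst (λ ys → count y ys ≤ 1) (map-∘ P) (subst (_≤ 1) (sym (count-right y)) (𝟙≤1 (T? (B y))))

    paired : ∀ {x} → T (A x) → (x , partner P x) ∈ P
    paired {x} Ax = partner-∈ P (≤-reflexive (sym (trans (count-left x) (𝟙-yes (T? (A x)) Ax))))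

  partner-bijective : IsBijectionOn A B (partner P)
  partner-bijective = into , injective , surjective
    where
    into : ∀ x → T (A x) → T (B (partner P x))
    into x Ax = 1≤𝟙⇒ (T? (B _)) (subst (1 ≤_) (count-right _) (∈⇒1≤count (∈-map⁺ proj₂ (paired Ax))))
    injective : ∀ x x' → T (A x) → T (A x') → partner P x ≡ partner P x' → x ≡ x'
    injective x x' Ax Ax' φx≡φx' = begin
      x                                  ≡⟨ partner-unique (map swap P) (right≤1 _) (∈-map⁺ swap (paired Ax)) ⟨
      partner (map swap P) (partner P x)  ≡⟨ cong (partner (map swap P)) φx≡φx' ⟩
      partner (map swap P) (partner P x') ≡⟨ partner-unique (map swap P) (right≤1 _) (∈-map⁺ swap (paired Ax')) ⟩
      x'                                 ∎
      where open ≡-Reasoning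
    surjective : ∀ y → T (B y) → Σ (Cube n) λ x → T (A x) × partner P x ≡ y
    surjective y By
      with (x , _) , xy∈P , refl ← ∈-map⁻ proj₂ (1≤count⇒∈ (map proj₂ P)
                                     (≤-reflexive (sym (trans (count-right y) (𝟙-yes (T? (B y)) By))))) =
      x , 1≤𝟙⇒ (T? (A x)) (subst (1 ≤_) (count-left x) (∈⇒1≤count (∈-map⁺ proj₁ xy∈P)))
        , partner-unique P (left≤1 x) xy∈P

  cost≡totalDist : cost P ≡ totalDist A (partner P)
  cost≡totalDist = begin
    cost P                                           ≡⟨ ∑-cong-All (All.tabulate on-graph) ⟩
    ∑ (λ e → dist (proj₁ e) (partner P (proj₁ e))) P ≡⟨ ∑-map (λ x → dist x (partner P x)) proj₁ P ⟨
    ∑ (λ x → dist x (partner P x)) (map proj₁ P)     ≡⟨ ∑-≋ _ {map proj₁ P} {elems A} (marginal₁ C) ⟩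
    totalDist A (partner P)                          ∎
    where
    open ≡-Reasoning
    on-graph : ∀ {e} → e ∈ P → dist (proj₁ e) (proj₂ e) ≡ dist (proj₁ e) (partner P (proj₁ e))
    on-graph {x , y} xy∈P = cong (dist x) (sym (partner-unique P (left≤1 x) xy∈P))

theorem2 : (n : ℕ) → 1 ≤ n → (A B : SubsetCube n)
    → card A ≡ 2 ^ (n ∸ 1) → card B ≡ 2 ^ (n ∸ 1)
    → Σ (Cube n → Cube n) (λ φ → IsBijectionOn A B φ
        × (totalDist A φ * totalDist A φ
            ≤ (2 ^ (n ∸ 1) * 2 ^ (n ∸ 1)) * (2 * n)))
theorem2 (suc m) _ A B |A| |B| =
  let P , C , 2cost≤ = coupling-within-imbalance (suc m) (elems A) (elems B) (trans |A| (sym |B|)) in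
  partner P , partner-bijective A B P C , (begin
    totalDist A (partner P) * totalDist A (partner P) ≡⟨ cong (λ t → t * t) (cost≡totalDist A B P C) ⟨
    cost P * cost P                                   ≤⟨ half-sum-square DA DB (cost P) 2cost≤
                                                           (imbalance-of-half m A |A|) (imbalance-of-half m B |B|) ⟩
    suc m * (L * L)                                   ≡⟨ *-comm (suc m) (L * L) ⟩
    L * L * suc m                                     ≤⟨ *-monoʳ-≤ (L * L) (m≤m+n (suc m) (suc m + 0)) ⟩
    L * L * (2 * suc m)                               ∎)
  where
  open ≤-Reasoning
  L  = 2 ^ m
  DA = imbalance (suc m) (elems A)
  DB = imbalance (suc m) (elems B)
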